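{- Let $a_0=0$ and let $(a_n)_{n\ge 1}$ be the increasing sequence of positive integers whose odd part is of the form $4k+1$. Let $d_n=a_{n+1}-a_n$ for $n\ge 0$. Then $(d_n)_{n\ge 0}$ is not $2$-automatic.
   Context: The odd part of a positive integer $m$ is $m/2^v$ with $2^v$ the largest power of $2$ dividing $m$. A sequence $(x_n)_{n\ge0}$ is $2$-automatic if its $2$-kernel $\{(x_{2^in+j})_{n\ge 0} : i\ge 0,\ 0\le j\le 2^i-1\}$ is finite. -}

module Defs where

open import Data.Nat using (ℕ; zero; suc; _+_; _*_; _∸_; _^_; _<_; _%_; _/_; _≡ᵇ_)
open import Data.Bool using (Bool; true; false; if_then_else_; _∧_; not)
open import Data.List using (List)
open import Data.List.Membership.Propositional using (_∈_)
open import Data.Product using (Σ; ∃; _×_)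
open import Relation.Binary.PropositionalEquality using (_≡_)

-- odd part of m: m / 2^v where 2^v is the largest power of 2 dividing m.
-- Computed by repeatedly halving while even (fuel m suffices); oddPart 0 = 0.
oddPartAux : ℕ → ℕ → ℕ
oddPartAux zero    m = m
oddPartAux (suc f) zero = zero
oddPartAux (suc f) (suc m) =
  if (suc m % 2) ≡ᵇ 0 then oddPartAux f (suc m / 2) else suc m

oddPart : ℕ → ℕ
oddPart m = oddPartAux m m

P : ℕ → Bool
P zero    = false
P (suc m) = (oddPart (suc m) % 4) ≡ᵇ 1

-- Among m+1,…,m+4 there are two odd
-- numbers differing by 2, one of which is ≡ 1 (mod 4), so a search over
-- m+1,…,m+4 always finds it (the final fallback is never reached wrongly).
next : ℕ → ℕ
next m = if P (m + 1) then m + 1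
         else if P (m + 2) then m + 2
         else if P (m + 3) then m + 3
         else m + 4

a : ℕ → ℕ
a zero    = 0
a (suc n) = next (a n)

d : ℕ → ℕ
d n = a (suc n) ∸ a n

-- 2-automatic: the 2-kernel { n ↦ x (2^i n + j) | i ≥ 0, 0 ≤ j < 2^i } is finite,
-- i.e. there is a finite list of sequences such that every kernel element
-- is (pointwise) equal to a member of the list.
TwoAutomatic : (ℕ → ℕ) → Set
TwoAutomatic x =
  Σ (List (ℕ → ℕ)) λ L →
    ∀ (i j : ℕ) → j < 2 ^ i →
      Σ (ℕ → ℕ) λ s → (s ∈ L) × (∀ n → x (2 ^ i * n + j) ≡ s n)

{-# OPTIONS --safe #-}
-- Let countP m be the number of x ∈ [1, m] with P x, so that a (countP m) = m whenever P m.
-- Since P (2 y) = P y and P is periodic mod 4 on odd numbers, countP (4 y) = countP (2 y) + y,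
-- hence countP (2 ^ (M + 1)) = 2 ^ M + 1; and P (2 ^ (M + 1) + x) = P x for 0 < x < 2 ^ M.
-- Together these give the self-similarity a (2 ^ M + 1 + n) = 2 ^ (M + 1) + a n, so
-- d (2 ^ M + 1 + r) = d r for r small compared with M.
-- A finite 2-kernel forces d (2 ^ I n + c) = d (2 ^ I n + c + t) for some t > 0; as
-- 2 ^ M + 1 ≡ 1 (mod 2 ^ I), the self-similarity moves this period from the class of c + 1 to
-- that of c, so d would have period t everywhere.  Then a (y + t) = a y + a t, making 3 · a t a
-- term of a; but the odd part of 3 s is 3 times that of s, so P (3 s) = not (P s).

module Submission where

open import Data.Bool using (Bool; true; false; not; if_then_else_)
open import Data.Fin using (Fin; toℕ)
open import Data.Fin.Properties using (pigeonhole; toℕ<n)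
open import Data.List using (length; lookup)
open import Data.List.Membership.Propositional using (_∈_)
open import Data.List.Relation.Unary.Any using (index)
open import Data.List.Relation.Unary.Any.Properties using (lookup-index)
open import Data.Nat
open import Data.Nat.DivMod
open import Data.Nat.Induction using (<-rec)
open import Data.Nat.Properties
open import Data.Nat.Tactic.RingSolver using (solve-∀)
open import Data.Product using (Σ; ∃₂; ∃-syntax; _×_; _,_; proj₁; proj₂)
open import Data.Sum using (inj₁; inj₂)
open import Relation.Binary.PropositionalEquality
open import Relation.Nullary using (¬_; contradiction)

open import Defs

n<2^n : ∀ n → n < 2 ^ n
n<2^n zero    = s≤s z≤n
n<2^n (suc n) = begin-strict
  suc n              ≤⟨ n<2^n n ⟩
  2 ^ n              <⟨ m<m+n (2 ^ n) (m^n>0 2 n) ⟩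
  2 ^ n + 2 ^ n      ≡⟨ cong (2 ^ n +_) (+-identityʳ (2 ^ n)) ⟨
  2 ^ suc n          ∎
  where open ≤-Reasoning

twoAutomatic⇒kernelCollision : ∀ {x} → TwoAutomatic x →
  ∃[ I ] ∃[ c ] ∃[ t ] 0 < t × ∀ n → x (2 ^ I * n + c) ≡ x (2 ^ I * n + c + t)
twoAutomatic⇒kernelCollision {x} (L , kernel) = collide (pigeonhole (n<1+n N) position)
  where
  N = length L
  element : (c : Fin (suc N)) → Σ (ℕ → ℕ) λ s → s ∈ L × (∀ n → x (2 ^ N * n + toℕ c) ≡ s n)
  element c = kernel N (toℕ c) (≤-<-trans (≤-pred (toℕ<n c)) (n<2^n N))
  position : Fin (suc N) → Fin N
  position c = index (proj₁ (proj₂ (element c)))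
  same-element : ∀ i j → position i ≡ position j → proj₁ (element i) ≡ proj₁ (element j)
  same-element i j same = begin
    proj₁ (element i)         ≡⟨ lookup-index (proj₁ (proj₂ (element i))) ⟩
    lookup L (position i)     ≡⟨ cong (lookup L) same ⟩
    lookup L (position j)     ≡⟨ lookup-index (proj₁ (proj₂ (element j))) ⟨
    proj₁ (element j)         ∎
    where open ≡-Reasoning
  collide : (∃₂ λ i j → toℕ i < toℕ j × position i ≡ position j) →
    ∃[ I ] ∃[ c ] ∃[ t ] 0 < t × ∀ n → x (2 ^ I * n + c) ≡ x (2 ^ I * n + c + t)
  collide (i , j , i<j , same) = N , toℕ i , toℕ j ∸ toℕ i , m<n⇒0<n∸m i<j , λ n → begin
    x (2 ^ N * n + toℕ i)                      ≡⟨ proj₂ (proj₂ (element i)) n ⟩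
    proj₁ (element i) n                        ≡⟨ cong (λ s → s n) (same-element i j same) ⟩
    proj₁ (element j) n                        ≡⟨ proj₂ (proj₂ (element j)) n ⟨
    x (2 ^ N * n + toℕ j)                      ≡⟨ cong (λ k → x (2 ^ N * n + k)) (m+[n∸m]≡n (<⇒≤ i<j)) ⟨
    x (2 ^ N * n + (toℕ i + (toℕ j ∸ toℕ i)))  ≡⟨ cong x (+-assoc (2 ^ N * n) (toℕ i) _) ⟨
    x (2 ^ N * n + toℕ i + (toℕ j ∸ toℕ i))    ∎
    where open ≡-Reasoning

oddPartAux-fuel : ∀ {f g} m → m ≤ f → m ≤ g → oddPartAux f m ≡ oddPartAux g m
oddPartAux-fuel {zero}  {zero}  zero _ _ = refl
oddPartAux-fuel {zero}  {suc g} zero _ _ = refl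
oddPartAux-fuel {suc f} {zero}  zero _ _ = refl
oddPartAux-fuel {suc f} {suc g} zero _ _ = refl
oddPartAux-fuel {suc f} {suc g} (suc m) (s≤s m≤f) (s≤s m≤g) with suc m % 2 ≡ᵇ 0
... | false = refl
... | true  = oddPartAux-fuel (suc m / 2) (≤-trans half≤m m≤f) (≤-trans half≤m m≤g)
  where
  half≤m : suc m / 2 ≤ m
  half≤m = ≤-pred (m/n<m (suc m) 2 (s≤s (s≤s z≤n)))

oddPart-double : ∀ h → oddPart (h * 2) ≡ oddPart h
oddPart-double zero = refl
oddPart-double (suc h) rewrite m*n%n≡0 (suc h) 2 ⦃ _ ⦄ | m*n/n≡m (suc h) 2 ⦃ _ ⦄ =
  oddPartAux-fuel (suc h) (s≤s (m≤m*n h 2)) ≤-refl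

oddPart-odd : ∀ m → m % 2 ≡ 1 → oddPart m ≡ m
oddPart-odd (suc m) odd rewrite odd = refl

P-double : ∀ h → P (h * 2) ≡ P h
P-double zero    = refl
P-double (suc h) = cong (λ o → o % 4 ≡ᵇ 1) (oddPart-double (suc h))

P-odd : ∀ m → m % 2 ≡ 1 → P m ≡ (m % 4 ≡ᵇ 1)
P-odd (suc m) odd = cong (λ o → o % 4 ≡ᵇ 1) (oddPart-odd (suc m) odd)

P-mod4 : ∀ i q → i < 4 → i % 2 ≡ 1 → P (i + q * 4) ≡ (i ≡ᵇ 1)
P-mod4 i q i<4 odd = begin
  P (i + q * 4)              ≡⟨ P-odd (i + q * 4) odd′ ⟩
  ((i + q * 4) % 4 ≡ᵇ 1)     ≡⟨ cong (_≡ᵇ 1) ([m+kn]%n≡m%n i q 4) ⟩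
  (i % 4 ≡ᵇ 1)               ≡⟨ cong (_≡ᵇ 1) (m<n⇒m%n≡m i<4) ⟩
  (i ≡ᵇ 1)                   ∎
  where
  open ≡-Reasoning
  odd′ : (i + q * 4) % 2 ≡ 1
  odd′ = trans (cong (λ k → (i + k) % 2) (sym (*-assoc q 2 2))) (trans ([m+kn]%n≡m%n i (q * 2) 2) odd)

P-1mod4 : ∀ q → P (1 + q * 4) ≡ true
P-1mod4 q = P-mod4 1 q (s≤s (s≤s z≤n)) refl

P-3mod4 : ∀ q → P (3 + q * 4) ≡ false
P-3mod4 q = P-mod4 3 q (s≤s (s≤s (s≤s (s≤s z≤n)))) refl

data Mod4 : ℕ → Set where
  mod4≡0 : ∀ q → Mod4 (q * 4)
  mod4≡1 : ∀ q → Mod4 (1 + q * 4)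
  mod4≡2 : ∀ q → Mod4 (2 + q * 4)
  mod4≡3 : ∀ q → Mod4 (3 + q * 4)

mod4 : ∀ n → Mod4 n
mod4 zero = mod4≡0 0
mod4 (suc n) with mod4 n
... | mod4≡0 q = mod4≡1 q
... | mod4≡1 q = mod4≡2 q
... | mod4≡2 q = mod4≡3 q
... | mod4≡3 q = mod4≡0 (suc q)

data ParityMod4 : ℕ → Set where
  even  : ∀ h → ParityMod4 (h * 2)
  1mod4 : ∀ q → ParityMod4 (1 + q * 4)
  3mod4 : ∀ q → ParityMod4 (3 + q * 4)

parityMod4 : ∀ n → ParityMod4 n
parityMod4 n with mod4 n
... | mod4≡0 q = subst ParityMod4 (*-assoc q 2 2) (even (q * 2))
... | mod4≡1 q = 1mod4 q
... | mod4≡2 q = subst ParityMod4 (cong (2 +_) (*-assoc q 2 2)) (even (1 + q * 2))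
... | mod4≡3 q = 3mod4 q

P-2^ : ∀ k → P (2 ^ k) ≡ true
P-2^ zero    = refl
P-2^ (suc k) = trans (cong P (*-comm 2 (2 ^ k))) (trans (P-double (2 ^ k)) (P-2^ k))

P-shift : ∀ M x → 0 < x → x < 2 ^ M → P (2 ^ suc M + x) ≡ P x
P-shift zero    (suc x) _ (s≤s ())
P-shift (suc M) x 0<x x<2^M with parityMod4 x
... | even h = begin
  P (2 ^ suc (suc M) + h * 2) ≡⟨ cong P (double (2 ^ M) h) ⟩
  P ((2 ^ suc M + h) * 2)     ≡⟨ P-double (2 ^ suc M + h) ⟩
  P (2 ^ suc M + h)           ≡⟨ P-shift M h (*-cancelʳ-< 2 0 h 0<x) h<2^M ⟩
  P h                         ≡⟨ P-double h ⟨
  P (h * 2)                   ∎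
  where
  open ≡-Reasoning
  double : ∀ p h → 2 * (2 * p) + h * 2 ≡ (2 * p + h) * 2
  double = solve-∀
  h<2^M : h < 2 ^ M
  h<2^M = *-cancelʳ-< 2 h (2 ^ M) (subst (h * 2 <_) (*-comm 2 (2 ^ M)) x<2^M)
... | 1mod4 q = trans (cong P (shift (2 ^ M) q)) (trans (P-1mod4 (2 ^ M + q)) (sym (P-1mod4 q)))
  where
  shift : ∀ p q → 2 * (2 * p) + (1 + q * 4) ≡ 1 + (p + q) * 4
  shift = solve-∀
... | 3mod4 q = trans (cong P (shift (2 ^ M) q)) (trans (P-3mod4 (2 ^ M + q)) (sym (P-3mod4 q)))
  where
  shift : ∀ p q → 2 * (2 * p) + (3 + q * 4) ≡ 3 + (p + q) * 4
  shift = solve-∀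

P-triple : ∀ s → 0 < s → P (3 * s) ≡ not (P s)
P-triple = <-rec (λ s → 0 < s → P (3 * s) ≡ not (P s)) triple
  where
  triple : ∀ s → (∀ {h} → h < s → 0 < h → P (3 * h) ≡ not (P h)) → 0 < s → P (3 * s) ≡ not (P s)
  triple s rec 0<s with parityMod4 s
  ... | even h = begin
    P (3 * (h * 2)) ≡⟨ cong P (*-assoc 3 h 2) ⟨
    P (3 * h * 2)   ≡⟨ P-double (3 * h) ⟩
    P (3 * h)       ≡⟨ rec (m<m*n h 2 ⦃ >-nonZero 0<h ⦄ (s≤s (s≤s z≤n))) 0<h ⟩
    not (P h)       ≡⟨ cong not (P-double h) ⟨
    not (P (h * 2)) ∎
    where
    open ≡-Reasoning
    0<h : 0 < h
    0<h = *-cancelʳ-< 2 0 h 0<s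
  ... | 1mod4 q = trans (cong P (triple1 q)) (trans (P-3mod4 (q * 3)) (cong not (sym (P-1mod4 q))))
    where
    triple1 : ∀ q → 3 * (1 + q * 4) ≡ 3 + q * 3 * 4
    triple1 = solve-∀
  ... | 3mod4 q = trans (cong P (triple3 q)) (trans (P-1mod4 (2 + q * 3)) (cong not (sym (P-3mod4 q))))
    where
    triple3 : ∀ q → 3 * (3 + q * 4) ≡ 1 + (2 + q * 3) * 4
    triple3 = solve-∀

P-within4 : ∀ m → P (m + 1) ≡ false → P (m + 2) ≡ false → P (m + 3) ≡ false → P (m + 4) ≡ true
P-within4 m e1 e2 e3 with mod4 m
... | mod4≡0 q = contradiction (trans (sym (P-1mod4 q)) (trans (cong P (+-comm 1 (q * 4))) e1)) λ ()
... | mod4≡1 q = trans (cong P (+-comm (1 + q * 4) 4)) (P-1mod4 (suc q))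
... | mod4≡2 q = contradiction (trans (sym (P-1mod4 (suc q))) (trans (cong P (+-comm 3 (2 + q * 4))) e3)) λ ()
... | mod4≡3 q = contradiction (trans (sym (P-1mod4 (suc q))) (trans (cong P (+-comm 2 (3 + q * 4))) e2)) λ ()

next-least : ∀ m → ∃[ j ] j < 4 × next m ≡ m + suc j × P (m + suc j) ≡ true
                                 × (∀ i → i < j → P (m + suc i) ≡ false)
next-least m with P (m + 1) in e1
... | true = 0 , s≤s z≤n , refl , e1 , λ _ ()
... | false with P (m + 2) in e2
... | true = 1 , s≤s (s≤s z≤n) , refl , e2 , λ { zero _ → e1 ; (suc _) (s≤s ()) }
... | false with P (m + 3) in e3
... | true = 2 , s≤s (s≤s (s≤s z≤n)) , refl , e3 , λ { zero _ → e1 ; (suc zero) _ → e2 ; (suc (suc _)) (s≤s (s≤s ())) }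
... | false = 3 , ≤-refl , refl , P-within4 m e1 e2 e3 ,
              λ { zero _ → e1 ; (suc zero) _ → e2 ; (suc (suc zero)) _ → e3
                ; (suc (suc (suc _))) (s≤s (s≤s (s≤s ()))) }

P-next : ∀ m → P (next m) ≡ true
P-next m with next-least m
... | j , _ , next≡ , found , _ = trans (cong P next≡) found

<-next : ∀ m → m < next m
<-next m with next-least m
... | j , _ , next≡ , _ = subst (m <_) (sym next≡) (m<m+n m (s≤s z≤n))

next≤+4 : ∀ m → next m ≤ m + 4
next≤+4 m with next-least m
... | j , j<4 , next≡ , _ = subst (_≤ m + 4) (sym next≡) (+-monoʳ-≤ m j<4)

P-between : ∀ m x → m < x → x < next m → P x ≡ false
P-between m x m<x x<next with next-least m | m≤n⇒∃[o]m+o≡n m<x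
... | j , _ , next≡ , _ , skipped | i , refl = trans (cong P (sym (+-suc m i))) (skipped i i<j)
  where
  i<j : i < j
  i<j = s<s⁻¹ (+-cancelˡ-< m (suc i) (suc j) (subst₂ _<_ (sym (+-suc m i)) next≡ x<next))

P-a : ∀ n → P (a (suc n)) ≡ true
P-a n = P-next (a n)

a-suc : ∀ n → a (suc n) ≡ a n + d n
a-suc n = sym (m+[n∸m]≡n (<⇒≤ (<-next (a n))))

a<2^ : ∀ n → a n < 2 ^ (2 + n)
a<2^ zero    = s≤s z≤n
a<2^ (suc n) = begin-strict
  a (suc n)                 ≤⟨ next≤+4 (a n) ⟩
  a n + 4                   <⟨ +-monoˡ-< 4 (a<2^ n) ⟩
  2 ^ (2 + n) + 4           ≤⟨ +-monoʳ-≤ (2 ^ (2 + n)) (^-monoʳ-≤ 2 (m≤m+n 2 n)) ⟩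
  2 ^ (2 + n) + 2 ^ (2 + n) ≡⟨ cong (2 ^ (2 + n) +_) (+-identityʳ (2 ^ (2 + n))) ⟨
  2 ^ (3 + n)               ∎
  where open ≤-Reasoning

a-bracket : ∀ m → ∃[ n ] a n ≤ m × m < a (suc n)
a-bracket zero = 0 , z≤n , <-next 0
a-bracket (suc m) with a-bracket m
... | n , an≤m , m<an′ with m≤n⇒m<n∨m≡n m<an′
... | inj₁ 1+m<an′ = n , m≤n⇒m≤1+n an≤m , 1+m<an′
... | inj₂ 1+m≡an′ = suc n , ≤-reflexive (sym 1+m≡an′) , subst (_< a (2 + n)) (sym 1+m≡an′) (<-next (a (suc n)))

fromBool : Bool → ℕ
fromBool b = if b then 1 else 0

countP : ℕ → ℕ
countP zero    = zero
countP (suc m) = countP m + fromBool (P (suc m))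

countP-skip : ∀ m j → (∀ i → i < j → P (m + suc i) ≡ false) → countP (m + j) ≡ countP m
countP-skip m zero    _       = cong countP (+-identityʳ m)
countP-skip m (suc j) skipped = begin
  countP (m + suc j)                          ≡⟨ cong countP (+-suc m j) ⟩
  countP (m + j) + fromBool (P (suc (m + j))) ≡⟨ cong (λ b → countP (m + j) + fromBool b) P≡false ⟩
  countP (m + j) + 0                          ≡⟨ +-identityʳ (countP (m + j)) ⟩
  countP (m + j)                              ≡⟨ countP-skip m j (λ i i<j → skipped i (m<n⇒m<1+n i<j)) ⟩
  countP m                                    ∎
  where
  open ≡-Reasoning
  P≡false : P (suc (m + j)) ≡ false
  P≡false = trans (cong P (sym (+-suc m j))) (skipped j ≤-refl)

countP-next : ∀ m → countP (next m) ≡ suc (countP m)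
countP-next m with next-least m
... | j , _ , next≡ , found , skipped = begin
  countP (next m)                             ≡⟨ cong countP (trans next≡ (+-suc m j)) ⟩
  countP (m + j) + fromBool (P (suc (m + j))) ≡⟨ cong₂ (λ c b → c + fromBool b) (countP-skip m j skipped) P≡true ⟩
  countP m + 1                                ≡⟨ +-comm (countP m) 1 ⟩
  suc (countP m)                              ∎
  where
  open ≡-Reasoning
  P≡true : P (suc (m + j)) ≡ true
  P≡true = trans (cong P (sym (+-suc m j))) found

countP-a : ∀ n → countP (a n) ≡ n
countP-a zero    = refl
countP-a (suc n) = trans (countP-next (a n)) (cong suc (countP-a n))

a-countP : ∀ m → P m ≡ true → a (countP m) ≡ m
a-countP m Pm with a-bracket m
... | n , an≤m , m<an′ with m≤n⇒m<n∨m≡n an≤m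
... | inj₁ an<m = contradiction (trans (sym Pm) (P-between (a n) m an<m m<an′)) λ ()
... | inj₂ an≡m = trans (cong a (trans (cong countP (sym an≡m)) (countP-a n))) an≡m

countP-+ : ∀ z x → (∀ y → 0 < y → y ≤ x → P (z + y) ≡ P y) → countP (z + x) ≡ countP z + countP x
countP-+ z zero    _    = trans (cong countP (+-identityʳ z)) (sym (+-identityʳ (countP z)))
countP-+ z (suc x) same = begin
  countP (z + suc x)                          ≡⟨ cong countP (+-suc z x) ⟩
  countP (z + x) + fromBool (P (suc (z + x))) ≡⟨ cong₂ (λ c b → c + fromBool b) (countP-+ z x same′) P≡ ⟩
  countP z + countP x + fromBool (P (suc x))  ≡⟨ +-assoc (countP z) (countP x) _ ⟩
  countP z + countP (suc x)                   ∎
  where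
  open ≡-Reasoning
  same′ : ∀ y → 0 < y → y ≤ x → P (z + y) ≡ P y
  same′ y 0<y y≤x = same y 0<y (m≤n⇒m≤1+n y≤x)
  P≡ : P (suc (z + x)) ≡ P (suc x)
  P≡ = trans (cong P (sym (+-suc z x))) (same (suc x) (s≤s z≤n) ≤-refl)

countP-*4 : ∀ y → countP (y * 4) ≡ countP (y * 2) + y
countP-*4 zero    = refl
countP-*4 (suc y)
  rewrite countP-*4 y | P-1mod4 y | P-3mod4 y | sym (*-assoc y 2 2)
        | P-double (1 + y * 2) | P-double (2 + y * 2) = regroup (countP (y * 2)) y _ _
  where
  regroup : ∀ c y u v → c + y + 1 + u + 0 + v ≡ c + u + v + suc y
  regroup = solve-∀

countP-2^ : ∀ M → countP (2 ^ suc M) ≡ suc (2 ^ M)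
countP-2^ zero    = refl
countP-2^ (suc M) = begin
  countP (2 * (2 * 2 ^ M))     ≡⟨ cong countP (quadruple (2 ^ M)) ⟩
  countP (2 ^ M * 4)           ≡⟨ countP-*4 (2 ^ M) ⟩
  countP (2 ^ M * 2) + 2 ^ M   ≡⟨ cong (λ k → countP k + 2 ^ M) (*-comm (2 ^ M) 2) ⟩
  countP (2 ^ suc M) + 2 ^ M   ≡⟨ cong (_+ 2 ^ M) (countP-2^ M) ⟩
  suc (2 ^ M + 2 ^ M)          ≡⟨ cong (λ k → suc (2 ^ M + k)) (+-identityʳ (2 ^ M)) ⟨
  suc (2 ^ suc M)              ∎
  where
  open ≡-Reasoning
  quadruple : ∀ p → 2 * (2 * p) ≡ p * 4
  quadruple = solve-∀

P-2^+a : ∀ M n → a n < 2 ^ M → P (2 ^ suc M + a n) ≡ true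
P-2^+a M zero    _       = trans (cong P (+-identityʳ (2 ^ suc M))) (P-2^ (suc M))
P-2^+a M (suc n) an<2^M = trans (P-shift M (a (suc n)) (≤-<-trans z≤n (<-next (a n))) an<2^M) (P-a n)

a-shift : ∀ M n → a n < 2 ^ M → a (2 ^ M + 1 + n) ≡ 2 ^ suc M + a n
a-shift M n an<2^M = begin
  a (2 ^ M + 1 + n)            ≡⟨ cong a count ⟨
  a (countP (2 ^ suc M + a n)) ≡⟨ a-countP _ (P-2^+a M n an<2^M) ⟩
  2 ^ suc M + a n              ∎
  where
  open ≡-Reasoning
  count : countP (2 ^ suc M + a n) ≡ 2 ^ M + 1 + n
  count = begin
    countP (2 ^ suc M + a n)          ≡⟨ countP-+ (2 ^ suc M) (a n) P-same ⟩
    countP (2 ^ suc M) + countP (a n) ≡⟨ cong₂ _+_ (countP-2^ M) (countP-a n) ⟩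
    suc (2 ^ M) + n                   ≡⟨ cong (_+ n) (+-comm 1 (2 ^ M)) ⟩
    2 ^ M + 1 + n                     ∎
    where
    P-same : ∀ y → 0 < y → y ≤ a n → P (2 ^ suc M + y) ≡ P y
    P-same y 0<y y≤an = P-shift M y 0<y (≤-<-trans y≤an an<2^M)

d-shift : ∀ M r → 3 + r ≤ M → d (2 ^ M + 1 + r) ≡ d r
d-shift M r 3+r≤M = begin
  a (suc (2 ^ M + 1 + r)) ∸ a (2 ^ M + 1 + r)   ≡⟨ cong₂ _∸_ shift₁ (a-shift M r (a<2^M r (n≤1+n r))) ⟩
  (2 ^ suc M + a (suc r)) ∸ (2 ^ suc M + a r)   ≡⟨ [m+n]∸[m+o]≡n∸o (2 ^ suc M) (a (suc r)) (a r) ⟩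
  d r                                           ∎
  where
  open ≡-Reasoning
  a<2^M : ∀ k → k ≤ suc r → a k < 2 ^ M
  a<2^M k k≤1+r = <-≤-trans (a<2^ k) (^-monoʳ-≤ 2 (≤-trans (+-monoʳ-≤ 2 k≤1+r) 3+r≤M))
  shift₁ : a (suc (2 ^ M + 1 + r)) ≡ 2 ^ suc M + a (suc r)
  shift₁ = trans (cong a (sym (+-suc (2 ^ M + 1) r))) (a-shift M (suc r) (a<2^M (suc r) ≤-refl))

Periodic : ℕ → Set
Periodic t = ∀ y → d y ≡ d (y + t)

a-additive : ∀ t → Periodic t → ∀ y → a (y + t) ≡ a y + a t
a-additive t periodic zero    = refl
a-additive t periodic (suc y) = begin
  a (suc (y + t))         ≡⟨ a-suc (y + t) ⟩
  a (y + t) + d (y + t)   ≡⟨ cong₂ _+_ (a-additive t periodic y) (sym (periodic y)) ⟩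
  a y + a t + d y         ≡⟨ swap (a y) (a t) (d y) ⟩
  a y + d y + a t         ≡⟨ cong (_+ a t) (a-suc y) ⟨
  a (suc y) + a t         ∎
  where
  open ≡-Reasoning
  swap : ∀ x y z → x + y + z ≡ x + z + y
  swap = solve-∀

d-aperiodic : ∀ t → 0 < t → ¬ Periodic t
d-aperiodic (suc t) _ periodic = contradiction (trans (sym (P-a (t + s + s))) P[3s]) λ ()
  where
  s = suc t
  a[3s] : a (s + s + s) ≡ 3 * a s
  a[3s] = begin
    a (s + s + s)       ≡⟨ a-additive s periodic (s + s) ⟩
    a (s + s) + a s     ≡⟨ cong (_+ a s) (a-additive s periodic s) ⟩
    a s + a s + a s     ≡⟨ thrice (a s) ⟩
    3 * a s             ∎
    where
    open ≡-Reasoning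
    thrice : ∀ x → x + x + x ≡ 3 * x
    thrice = solve-∀
  P[3s] : P (a (s + s + s)) ≡ false
  P[3s] = trans (cong P a[3s]) (trans (P-triple (a s) (≤-<-trans z≤n (<-next (a t)))) (cong not (P-a t)))

PeriodicOnClass : (I c t : ℕ) → Set
PeriodicOnClass I c t = ∀ n → d (2 ^ I * n + c) ≡ d (2 ^ I * n + c + t)

periodicOnClass-pred : ∀ I c t → PeriodicOnClass I (suc c) t → PeriodicOnClass I c t
-- 2 ^ M + 1 + r lies in the class of suc c modulo 2 ^ I, and d-shift applies at both ends.
periodicOnClass-pred I c t periodic n = begin
  d r                                 ≡⟨ d-shift M r (≤-trans (+-monoʳ-≤ 3 (m≤m+n r t)) 3+r+t≤M) ⟨
  d (2 ^ M + 1 + r)                   ≡⟨ cong d lift₀ ⟩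
  d (2 ^ I * (2 ^ T + n) + suc c)     ≡⟨ periodic (2 ^ T + n) ⟩
  d (2 ^ I * (2 ^ T + n) + suc c + t) ≡⟨ cong d lift₁ ⟨
  d (2 ^ M + 1 + (r + t))             ≡⟨ d-shift M (r + t) 3+r+t≤M ⟩
  d (r + t)                           ∎
  where
  open ≡-Reasoning
  r = 2 ^ I * n + c
  T = 3 + (r + t)
  M = I + T
  3+r+t≤M : 3 + (r + t) ≤ M
  3+r+t≤M = m≤n+m T I
  2^M≡ : 2 ^ M ≡ 2 ^ I * 2 ^ T
  2^M≡ = ^-distribˡ-+-* 2 I T
  lift₀ : 2 ^ M + 1 + r ≡ 2 ^ I * (2 ^ T + n) + suc c
  lift₀ = trans (cong (λ p → p + 1 + r) 2^M≡) (ring (2 ^ I) (2 ^ T) n c)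
    where
    ring : ∀ x y n c → x * y + 1 + (x * n + c) ≡ x * (y + n) + suc c
    ring = solve-∀
  lift₁ : 2 ^ M + 1 + (r + t) ≡ 2 ^ I * (2 ^ T + n) + suc c + t
  lift₁ = trans (cong (λ p → p + 1 + (r + t)) 2^M≡) (ring (2 ^ I) (2 ^ T) n c t)
    where
    ring : ∀ x y n c t → x * y + 1 + (x * n + c + t) ≡ x * (y + n) + suc c + t
    ring = solve-∀

periodicOnClass-sub : ∀ I j c t → PeriodicOnClass I (j + c) t → PeriodicOnClass I c t
periodicOnClass-sub I zero    c t periodic = periodic
periodicOnClass-sub I (suc j) c t periodic =
  periodicOnClass-sub I j c t (periodicOnClass-pred I (j + c) t periodic)

periodicOnClass-+ : ∀ I c t y → PeriodicOnClass I c t → PeriodicOnClass I (2 ^ I * y + c) t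
periodicOnClass-+ I c t y periodic n =
  subst (λ k → d k ≡ d (k + t)) (regroup (2 ^ I) n y c) (periodic (n + y))
  where
  regroup : ∀ p n y c → p * (n + y) + c ≡ p * n + (p * y + c)
  regroup = solve-∀

periodicOnClass⇒periodic : ∀ I c t → PeriodicOnClass I c t → Periodic t
periodicOnClass⇒periodic I c t periodic y =
  subst (λ k → d k ≡ d (k + t)) (cong (_+ y) (*-zeroʳ (2 ^ I))) (periodicAt-y 0)
  where
  c′ = 2 ^ I * y + c
  y≤c′ : y ≤ c′
  y≤c′ = ≤-trans (m≤n*m y (2 ^ I) ⦃ >-nonZero (m^n>0 2 I) ⦄) (m≤m+n (2 ^ I * y) c)
  periodicAt-y : PeriodicOnClass I y t
  periodicAt-y = periodicOnClass-sub I (c′ ∸ y) y t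
    (subst (λ k → PeriodicOnClass I k t) (sym (m∸n+n≡m y≤c′)) (periodicOnClass-+ I c t y periodic))

theorem10 : ¬ TwoAutomatic d
theorem10 automatic with twoAutomatic⇒kernelCollision {d} automatic
... | I , c , t , 0<t , collision = d-aperiodic t 0<t (periodicOnClass⇒periodic I c t collision)
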